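{- Let $\mathcal{S}$ be a single-set cubical $(\omega,0)$-category with connections. Then every cell $x\in\mathcal{S}$ is $r_i$-invertible for each $i\in\mathbb{N}_+$.
   Context: A single-set category is a set $\mathcal{S}$ with $\delta^-,\delta^+:\mathcal{S}\to\mathcal{S}$ and $\odot:\mathcal{S}\times\mathcal{S}\to\mathcal{P}(\mathcal{S})$ (extended to subsets by unions) with $\{x\}\odot(y\odot z)=(x\odot y)\odot\{z\}$, $x\odot\delta^+x=\{x\}=\delta^-x\odot x$, $x\odot y\neq\varnothing\iff\delta^+x=\delta^-y$, and $|x\odot y|\leq1$; $\Delta(x,y)$ means $x\odot y\neq\varnothing$ and $x\circ y$ is its element. A single-set cubical $\omega$-category with connections is a set $\mathcal{S}$ with, for each $i\in\mathbb{N}_+$, a single-set category structure $(\delta_i^\pm,\odot_i)$ (with $\Delta_i,\circ_i$) and maps $s_i,\tilde s_i,\gamma_i^-,\gamma_i^+:\mathcal{S}\to\mathcal{S}$; with $\mathcal{S}^i$ the fixed points of $\delta_i^-$ (equivalently $\delta_i^+$), $\mathcal{S}^{i_1,\dots,i_k}=\bigcap_l\mathcal{S}^{i_l}$, $\mathcal{S}^{>n}=\bigcap_{i>n}\mathcal{S}^i$, the axioms (for all $i,j$, $\alpha,\beta\in\{ -,+\}$) are: $\delta_i^\alpha\delta_j^\beta=\delta_j^\beta\delta_i^\alpha$ ($i\neq j$); $\delta_i^\alpha(x\circ_jy)=\delta_i^\alpha x\circ_j\delta_i^\alpha y$ ($i\neq j$, $\Delta_j(x,y)$); $(w\circ_ix)\circ_j(y\circ_iz)=(w\circ_jy)\circ_i(x\circ_jz)$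 ($i\neq j$, $\Delta_i(w,x),\Delta_i(y,z),\Delta_j(w,y),\Delta_j(x,z)$); $s_i(\mathcal{S}^i)\subseteq\mathcal{S}^{i+1}$, $\tilde s_i(\mathcal{S}^{i+1})\subseteq\mathcal{S}^i$; $\tilde s_is_ix=x$ ($x\in\mathcal{S}^i$), $s_i\tilde s_iy=y$ ($y\in\mathcal{S}^{i+1}$); for $x\in\mathcal{S}^j$: $\delta_j^\alpha s_jx=s_j\delta_{j+1}^\alpha x$, $\delta_i^\alpha s_jx=s_j\delta_i^\alpha x$ ($i\neq j,j+1$); for $x,y\in\mathcal{S}^i$: $s_i(x\circ_{i+1}y)=s_ix\circ_is_iy$ ($\Delta_{i+1}(x,y)$), $s_i(x\circ_jy)=s_ix\circ_js_iy$ ($j\neq i,i+1$, $\Delta_j(x,y)$); $s_ix=x$ on $\mathcal{S}^{i,i+1}$; $s_is_jx=s_js_ix$ ($|i-j|\geq2$, $x\in\mathcal{S}^{i,j}$); for every $x$ there is $k$ with $x\in\mathcal{S}^i$ for all $i\geq k+1$; for $x\in\mathcal{S}^j$: $\delta_j^\alpha\gamma_j^\alpha x=x$, $\delta_{j+1}^\alpha\gamma_j^\alpha x=s_jx$, $\delta_i^\alpha\gamma_j^\beta x=\gamma_j^\beta\delta_i^\alpha x$ ($i\neq j,j+1$); for $x,y\in\mathcal{S}^i$ with $\Delta_{i+1}(x,y)$: $\gamma_i^+(x\circ_{i+1}y)=(\gamma_i^+x\circ_{i+1}s_ix)\circ_i(x\circ_{i+1}\gamma_i^+y)$, $\gamma_i^-(x\circ_{i+1}y)=(\gamma_i^-x\circ_{i+1}y)\circ_i(s_iy\circ_{i+1}\gamma_i^-y)$;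 $\gamma_i^\alpha(x\circ_jy)=\gamma_i^\alpha x\circ_j\gamma_i^\alpha y$ ($x,y\in\mathcal{S}^i$, $j\neq i,i+1$, $\Delta_j(x,y)$); $\gamma_i^\alpha x=x$ on $\mathcal{S}^{i,i+1}$; $\gamma_i^+x\circ_{i+1}\gamma_i^-x=x$, $\gamma_i^+x\circ_i\gamma_i^-x=s_ix$ ($x\in\mathcal{S}^i$); $\gamma_i^\alpha\gamma_j^\beta x=\gamma_j^\beta\gamma_i^\alpha x$ ($|i-j|\geq2$, $x\in\mathcal{S}^{i,j}$); $s_{i+1}s_i\gamma_{i+1}^\alpha x=\gamma_i^\alpha s_{i+1}x$ ($x\in\mathcal{S}^{i,i+1}$). A cell $x$ is $r_i$-invertible if there is $y$ with $\Delta_i(x,y)$, $x\circ_iy=\delta_i^-x$, $\Delta_i(y,x)$, $y\circ_ix=\delta_i^+x$. A cell $x\in\mathcal{S}^{>n}$ has an $r_i$-invertible $(n-1)$-shell if $\delta_j^\alpha x$ is $r_i$-invertible for every $1\leq j\leq n$ with $j\neq i$ and both $\alpha$. A single-set cubical $(\omega,0)$-category (with connections) is such an $\mathcal{S}$ in which, for all $n\geq1$ and $1\leq i\leq n$, every $x\in\mathcal{S}^{>n}$ with an $r_i$-invertible $(n-1)$-shell is $r_i$-invertible. -}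

module Defs where

open import Data.Nat using (ℕ; suc; _+_; _≤_; _<_)
open import Data.Product using (Σ; _×_; ∃; ∃-syntax; _,_)
open import Data.Sum using (_⊎_)
open import Function.Bundles using (_⇔_)
open import Relation.Binary.PropositionalEquality using (_≡_)
open import Relation.Nullary using (¬_)

-- Conventions.
-- * A subset of S (an element of P(S)) is a predicate S → Set.
-- * The partial composition ⊙ : S × S → P(S) is given as a ternary
--   relation  Comp x y z  meaning  z ∈ x ⊙ y.
-- * The directions ± are the two elements of Sgn.
-- * INDEXING: the paper's directions i ∈ ℕ₊ = {1,2,3,...} are encoded
--   0-based: the Agda index k : ℕ stands for the paper's direction k+1.

data Sgn : Set where
  neg pos : Sgn

record IsSingleSetCategory (S : Set) (δ⁻ δ⁺ : S → S)
                           (Comp : S → S → S → Set) : Set₁ where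
  field
    assoc    : ∀ x y z w →
               (∃[ u ] (Comp y z u × Comp x u w)) ⇔ (∃[ u ] (Comp x y u × Comp u z w))
    unitʳ    : ∀ x w → Comp x (δ⁺ x) w ⇔ (w ≡ x)
    unitˡ    : ∀ x w → Comp (δ⁻ x) x w ⇔ (w ≡ x)
    defined  : ∀ x y → (∃[ z ] Comp x y z) ⇔ (δ⁺ x ≡ δ⁻ y)
    unique   : ∀ x y z z' → Comp x y z → Comp x y z' → z ≡ z'

record CubicalData : Set₁ where
  field
    S    : Set
    δ    : ℕ → Sgn → S → S
    Comp : ℕ → S → S → S → Set
    s    : ℕ → S → S
    s̃    : ℕ → S → S
    γ    : ℕ → Sgn → S → S

  Cell : ℕ → S → Set
  Cell k x = δ k neg x ≡ x

  Δ : ℕ → S → S → Set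
  Δ k x y = ∃[ z ] Comp k x y z

  RInvertible : ℕ → S → Set
  RInvertible k x = ∃[ y ] (Comp k x y (δ k neg x) × Comp k y x (δ k pos x))

  -- x ∈ S^{>n}  (paper's n; 1-based directions m+1 > n  ⇔  n ≤ m)
  Above : ℕ → S → Set
  Above n x = ∀ m → n ≤ m → Cell m x

  InvertibleShell : ℕ → ℕ → S → Set
  InvertibleShell n k x = ∀ j → j < n → ¬ (j ≡ k) → ∀ α → RInvertible k (δ j α x)

FarApart : ℕ → ℕ → Set
FarApart i j = (suc (suc i) ≤ j) ⊎ (suc (suc j) ≤ i)

-- An equation  "a = b ∘ c"  between (partial) terms is rendered as
-- "a ∈ b ⊙ c"; composites occurring inside terms are named and asserted
-- to exist.
record IsCubicalOmegaCategory (C : CubicalData) : Set₁ where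
  open CubicalData C
  field
    isCat : ∀ i → IsSingleSetCategory S (δ i neg) (δ i pos) (Comp i)

    δ-comm : ∀ i j α β x → ¬ (i ≡ j) → δ i α (δ j β x) ≡ δ j β (δ i α x)
    δ-comp : ∀ i j α x y z → ¬ (i ≡ j) → Comp j x y z →
             Comp j (δ i α x) (δ i α y) (δ i α z)
    interchange : ∀ i j w x y z a b c d → ¬ (i ≡ j) →
             Comp i w x a → Comp i y z b → Comp j w y c → Comp j x z d →
             ∃[ e ] (Comp j a b e × Comp i c d e)

    s-cell  : ∀ i x → Cell i x → Cell (suc i) (s i x)
    s̃-cell  : ∀ i y → Cell (suc i) y → Cell i (s̃ i y)
    s̃s      : ∀ i x → Cell i x → s̃ i (s i x) ≡ x
    ss̃      : ∀ i y → Cell (suc i) y → s i (s̃ i y) ≡ y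
    δ-s-same : ∀ j α x → Cell j x → δ j α (s j x) ≡ s j (δ (suc j) α x)
    δ-s-other : ∀ i j α x → Cell j x → ¬ (i ≡ j) → ¬ (i ≡ suc j) →
             δ i α (s j x) ≡ s j (δ i α x)
    s-comp-next : ∀ i x y z → Cell i x → Cell i y → Comp (suc i) x y z →
             Comp i (s i x) (s i y) (s i z)
    s-comp-other : ∀ i j x y z → Cell i x → Cell i y → ¬ (j ≡ i) → ¬ (j ≡ suc i) →
             Comp j x y z → Comp j (s i x) (s i y) (s i z)
    s-id    : ∀ i x → Cell i x → Cell (suc i) x → s i x ≡ x
    s-comm  : ∀ i j x → FarApart i j → Cell i x → Cell j x →
             s i (s j x) ≡ s j (s i x)
    finite-dim : ∀ x → ∃[ k ] (∀ i → k ≤ i → Cell i x)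

    δ-γ-same : ∀ j α x → Cell j x → δ j α (γ j α x) ≡ x
    δ-γ-next : ∀ j α x → Cell j x → δ (suc j) α (γ j α x) ≡ s j x
    δ-γ-other : ∀ i j α β x → Cell j x → ¬ (i ≡ j) → ¬ (i ≡ suc j) →
             δ i α (γ j β x) ≡ γ j β (δ i α x)
    γ⁺-comp-next : ∀ i x y z → Cell i x → Cell i y → Comp (suc i) x y z →
             ∃[ a ] ∃[ b ] (Comp (suc i) (γ i pos x) (s i x) a ×
                            Comp (suc i) x (γ i pos y) b ×
                            Comp i a b (γ i pos z))
    γ⁻-comp-next : ∀ i x y z → Cell i x → Cell i y → Comp (suc i) x y z →
             ∃[ a ] ∃[ b ] (Comp (suc i) (γ i neg x) y a ×
                            Comp (suc i) (s i y) (γ i neg y) b ×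
                            Comp i a b (γ i neg z))
    γ-comp-other : ∀ i j α x y z → Cell i x → Cell i y → ¬ (j ≡ i) → ¬ (j ≡ suc i) →
             Comp j x y z → Comp j (γ i α x) (γ i α y) (γ i α z)
    γ-id    : ∀ i α x → Cell i x → Cell (suc i) x → γ i α x ≡ x
    γ-inv-next : ∀ i x → Cell i x → Comp (suc i) (γ i pos x) (γ i neg x) x
    γ-inv-same : ∀ i x → Cell i x → Comp i (γ i pos x) (γ i neg x) (s i x)
    γ-comm  : ∀ i j α β x → FarApart i j → Cell i x → Cell j x →
             γ i α (γ j β x) ≡ γ j β (γ i α x)
    ssγ     : ∀ i α x → Cell i x → Cell (suc i) x →
             s (suc i) (s i (γ (suc i) α x)) ≡ γ i α (s (suc i) x)

record CubicalOmegaCategory : Set₂ where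
  field
    cdata : CubicalData
    isCubical : IsCubicalOmegaCategory cdata
  open CubicalData cdata public
  open IsCubicalOmegaCategory isCubical public

IsOmega0 : CubicalOmegaCategory → Set
IsOmega0 C = ∀ n k → 1 ≤ n → k < n → ∀ x → Above n x → InvertibleShell n k x →
             RInvertible k x
  where open CubicalOmegaCategory C

-- Induct on the n with x ∈ S^{>n}. For x ∈ S^{>n+1} and a direction i ≤ n+1,
-- the (ω,0) axiom reduces r_i-invertibility of x to that of its faces
-- δ_j^α x (j ≠ i). Such a face y lies in S^j ∩ S^{>n+1}, and the degeneracies
-- s_j, s_{j+1}, …, s_n carry it into S^{>n}, where the induction hypothesis
-- applies. Invertibility descends along s_j: it is injective on S^j, turns
-- ⊙_{j+1} into ⊙_j and preserves the other compositions, and an inverse of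
-- s_j y is pushed into the image of s_j by the face δ_{j+1}^-.
module Submission where

open import Defs
open import Data.Nat using (ℕ; zero; suc; _+_; _∸_; _≤_; _<_; z≤n; s≤s; _≟_; _≤?_)
open import Data.Nat.Properties
  using (1+n≢n; <⇒≢; ≤-trans; n≤1+n; m≤m+n; ≤∧≢⇒<; ≰⇒>; m+[n∸m]≡n; +-suc; +-identityʳ)
open import Data.Product using (∃-syntax; _×_; _,_)
open import Function using (_∘_)
open import Data.Sum using (_⊎_; inj₁; inj₂)
open import Function.Bundles using (Equivalence)
open import Relation.Binary.PropositionalEquality
open import Relation.Nullary using (yes; no)

module SingleSetCategoryProperties
  {S : Set} {δ⁻ δ⁺ : S → S} {Comp : S → S → S → Set}
  (cat : IsSingleSetCategory S δ⁻ δ⁺ Comp) where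

  open IsSingleSetCategory cat

  Comp-≡ : ∀ {a a' b b' c c'} → a ≡ a' → b ≡ b' → c ≡ c' → Comp a b c → Comp a' b' c'
  Comp-≡ refl refl refl abc = abc

  Comp-unitˡ : ∀ x → Comp (δ⁻ x) x x
  Comp-unitˡ x = Equivalence.from (unitˡ x x) refl

  Comp-unitʳ : ∀ x → Comp x (δ⁺ x) x
  Comp-unitʳ x = Equivalence.from (unitʳ x x) refl

  Comp⇒δ⁺≡δ⁻ : ∀ {x y z} → Comp x y z → δ⁺ x ≡ δ⁻ y
  Comp⇒δ⁺≡δ⁻ {x} {y} {z} xyz = Equivalence.to (defined x y) (z , xyz)

  δ⁺≡δ⁻⇒Composable : ∀ {x y} → δ⁺ x ≡ δ⁻ y → ∃[ z ] Comp x y z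
  δ⁺≡δ⁻⇒Composable = Equivalence.from (defined _ _)

  Comp-unique : ∀ {x y z z'} → Comp x y z → Comp x y z' → z ≡ z'
  Comp-unique = unique _ _ _ _

  δ⁺∘δ⁻ : ∀ x → δ⁺ (δ⁻ x) ≡ δ⁻ x
  δ⁺∘δ⁻ x = Comp⇒δ⁺≡δ⁻ (Comp-unitˡ x)

  δ⁻∘δ⁺ : ∀ x → δ⁻ (δ⁺ x) ≡ δ⁺ x
  δ⁻∘δ⁺ x = sym (Comp⇒δ⁺≡δ⁻ (Comp-unitʳ x))

  δ⁺-fixed⇒δ⁻-fixed : ∀ {u} → δ⁺ u ≡ u → δ⁻ u ≡ u
  δ⁺-fixed⇒δ⁻-fixed {u} δ⁺u≡u =
    trans (sym (Comp⇒δ⁺≡δ⁻ (Comp-≡ refl δ⁺u≡u refl (Comp-unitʳ u)))) δ⁺u≡u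

  δ⁻-fixed⇒δ⁺-fixed : ∀ {u} → δ⁻ u ≡ u → δ⁺ u ≡ u
  δ⁻-fixed⇒δ⁺-fixed {u} δ⁻u≡u =
    trans (Comp⇒δ⁺≡δ⁻ (Comp-≡ δ⁻u≡u refl refl (Comp-unitˡ u))) δ⁻u≡u

  δ⁻-fixed⇒self-inverse : ∀ {x} → δ⁻ x ≡ x → Comp x x (δ⁻ x) × Comp x x (δ⁺ x)
  δ⁻-fixed⇒self-inverse {x} δ⁻x≡x =
      Comp-≡ refl refl (sym δ⁻x≡x) xxx
    , Comp-≡ refl refl (sym (δ⁻-fixed⇒δ⁺-fixed δ⁻x≡x)) xxx
    where
      xxx : Comp x x x
      xxx = Comp-≡ δ⁻x≡x refl refl (Comp-unitˡ x)

-- Transport j k k' : the degeneracy s_j sends k-compositions to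
-- k'-compositions (direction j+1 becomes j, directions other than j, j+1 stay).
data Transport (j : ℕ) : ℕ → ℕ → Set where
  next  : Transport j (suc j) j
  other : ∀ k → k ≢ j → k ≢ suc j → Transport j k k

Transport-source≢ : ∀ {j k k'} → Transport j k k' → j ≢ k
Transport-source≢ next            = 1+n≢n ∘ sym
Transport-source≢ (other k k≢j _) = k≢j ∘ sym

Transport-target≢ : ∀ {j k k'} → Transport j k k' → suc j ≢ k'
Transport-target≢ next              = 1+n≢n
Transport-target≢ (other k _ k≢1+j) = k≢1+j ∘ sym

transport? : ∀ j k → k ≡ j ⊎ ∃[ k' ] Transport j k k'
transport? j k with k ≟ j
... | yes k≡j = inj₁ k≡j
... | no k≢j with k ≟ suc j
...   | yes refl  = inj₂ (j , next)
...   | no k≢1+j = inj₂ (k , other k k≢j k≢1+j)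

module CubicalProperties (C : CubicalOmegaCategory) where

  open CubicalOmegaCategory C
  module Cat i = SingleSetCategoryProperties (isCat i)
  open Cat using (Comp-≡; Comp-unique; Comp⇒δ⁺≡δ⁻)

  Cell-δ : ∀ i α x → Cell i (δ i α x)
  Cell-δ i neg x = Cat.δ⁺-fixed⇒δ⁻-fixed i (Cat.δ⁺∘δ⁻ i x)
  Cell-δ i pos x = Cat.δ⁻∘δ⁺ i x

  Cell-δ-other : ∀ {i j} α {x} → i ≢ j → Cell i x → Cell i (δ j α x)
  Cell-δ-other {i} {j} α {x} i≢j x∈Sⁱ = trans (δ-comm i j neg α x i≢j) (cong (δ j α) x∈Sⁱ)

  Cell-comp : ∀ {j k a b c} → j ≢ k → Cell j a → Cell j b → Comp k a b c → Cell j c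
  Cell-comp {j} {k} {a} {b} {c} j≢k a∈Sʲ b∈Sʲ abc =
    Comp-unique k (Comp-≡ k a∈Sʲ b∈Sʲ refl (δ-comp j k neg a b c j≢k abc)) abc

  Cell⇒RInvertible : ∀ {i x} → Cell i x → RInvertible i x
  Cell⇒RInvertible {i} {x} x∈Sⁱ = x , Cat.δ⁻-fixed⇒self-inverse i x∈Sⁱ

  s-injective : ∀ {j a b} → Cell j a → Cell j b → s j a ≡ s j b → a ≡ b
  s-injective {j} {a} {b} a∈Sʲ b∈Sʲ sa≡sb = begin
    a               ≡⟨ s̃s j a a∈Sʲ ⟨
    s̃ j (s j a)     ≡⟨ cong (s̃ j) sa≡sb ⟩
    s̃ j (s j b)     ≡⟨ s̃s j b b∈Sʲ ⟩
    b               ∎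
    where open ≡-Reasoning

  δ-s : ∀ {j k k'} → Transport j k k' → ∀ α {a} → Cell j a →
        δ k' α (s j a) ≡ s j (δ k α a)
  δ-s {j} next                  α {a} a∈Sʲ = δ-s-same j α a a∈Sʲ
  δ-s {j} (other k k≢j k≢1+j) α {a} a∈Sʲ = δ-s-other k j α a a∈Sʲ k≢j k≢1+j

  s-comp : ∀ {j k k'} → Transport j k k' → ∀ {a b c} → Cell j a → Cell j b →
           Comp k a b c → Comp k' (s j a) (s j b) (s j c)
  s-comp {j} next                a∈Sʲ b∈Sʲ abc = s-comp-next j _ _ _ a∈Sʲ b∈Sʲ abc
  s-comp {j} (other k k≢j k≢1+j) a∈Sʲ b∈Sʲ abc =
    s-comp-other j k _ _ _ a∈Sʲ b∈Sʲ k≢j k≢1+j abc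

  module _ {j k k'} (t : Transport j k k') where

    s-reflects-comp : ∀ {a b c} → Cell j a → Cell j b → Cell j c →
                      Comp k' (s j a) (s j b) (s j c) → Comp k a b c
    s-reflects-comp {a} {b} {c} a∈Sʲ b∈Sʲ c∈Sʲ sabc
      with Cat.δ⁺≡δ⁻⇒Composable k matching
      where
        j≢k = Transport-source≢ t
        matching : δ k pos a ≡ δ k neg b
        matching = s-injective (Cell-δ-other pos j≢k a∈Sʲ) (Cell-δ-other neg j≢k b∈Sʲ)
          (trans (sym (δ-s t pos a∈Sʲ)) (trans (Comp⇒δ⁺≡δ⁻ k' sabc) (δ-s t neg b∈Sʲ)))
    ... | d , abd = Comp-≡ k refl refl d≡c abd
      where
        d≡c : d ≡ c
        d≡c = s-injective (Cell-comp (Transport-source≢ t) a∈Sʲ b∈Sʲ abd) c∈Sʲ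
                (Comp-unique k' (s-comp t a∈Sʲ b∈Sʲ abd) sabc)

    s-reflects-RInvertible : ∀ {x} → Cell j x → RInvertible k' (s j x) → RInvertible k x
    s-reflects-RInvertible {x} x∈Sʲ (z , sxz , zsx) =
        y
      , s-reflects-comp x∈Sʲ y∈Sʲ (Cell-δ-other neg j≢k x∈Sʲ) (δʲ⁺¹-comp sxz sx∈Sʲ⁺¹ (sym sy≡w))
      , s-reflects-comp y∈Sʲ x∈Sʲ (Cell-δ-other pos j≢k x∈Sʲ) (δʲ⁺¹-comp zsx (sym sy≡w) sx∈Sʲ⁺¹)
      where
        j≢k = Transport-source≢ t
        sx∈Sʲ⁺¹ : Cell (suc j) (s j x)
        sx∈Sʲ⁺¹ = s-cell j x x∈Sʲ
        -- z need not lie in the image of s_j, but its face w does, and w is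
        -- again an inverse of s_j x since δ_{j+1}^- fixes s_j x and its faces.
        w = δ (suc j) neg z
        y = s̃ j w
        y∈Sʲ : Cell j y
        y∈Sʲ = s̃-cell j w (Cell-δ (suc j) neg z)
        sy≡w : s j y ≡ w
        sy≡w = ss̃ j w (Cell-δ (suc j) neg z)
        δʲ⁺¹-face : ∀ α → δ (suc j) neg (δ k' α (s j x)) ≡ s j (δ k α x)
        δʲ⁺¹-face α = trans (δ-comm (suc j) k' neg α (s j x) (Transport-target≢ t))
                        (trans (cong (δ k' α) sx∈Sʲ⁺¹) (δ-s t α x∈Sʲ))
        δʲ⁺¹-comp : ∀ {a b α a' b'} → Comp k' a b (δ k' α (s j x)) →
                    δ (suc j) neg a ≡ a' → δ (suc j) neg b ≡ b' →
                    Comp k' a' b' (s j (δ k α x))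
        δʲ⁺¹-comp {α = α} ab a≡ b≡ =
          Comp-≡ k' a≡ b≡ (δʲ⁺¹-face α)
            (δ-comp (suc j) k' neg _ _ _ (Transport-target≢ t) ab)

  Above-δ : ∀ {n j} α {x} → j < n → Above n x → Above n (δ j α x)
  Above-δ α j<n x∈S>n m n≤m = Cell-δ-other α (<⇒≢ (≤-trans j<n n≤m) ∘ sym) (x∈S>n m n≤m)

  Above-s : ∀ {n j y} → suc j < n → Cell j y → Above n y → Above n (s j y)
  Above-s {j = j} {y} 1+j<n y∈Sʲ y∈S>n m n≤m =
    trans (δ-s-other m j neg y y∈Sʲ (<⇒≢ (≤-trans (≤-trans (n≤1+n _) 1+j<n) n≤m) ∘ sym)
                                   (<⇒≢ (≤-trans 1+j<n n≤m) ∘ sym))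
          (cong (s j) (y∈S>n m n≤m))

  Above-suc⇒Above : ∀ {n y} → Cell n y → Above (suc n) y → Above n y
  Above-suc⇒Above {n} y∈Sⁿ y∈S>n+1 m n≤m with m ≟ n
  ... | yes refl = y∈Sⁿ
  ... | no m≢n   = y∈S>n+1 m (≤∧≢⇒< n≤m (m≢n ∘ sym))

  AllRInvertibleAbove : ℕ → Set
  AllRInvertibleAbove n = ∀ x → Above n x → ∀ k → RInvertible k x

  RInvertible-below : ∀ {n} → AllRInvertibleAbove n →
                      ∀ d j → j + d ≡ n → ∀ {y} → Cell j y → Above (suc n) y →
                      ∀ k → RInvertible k y
  RInvertible-below ih zero j j+0≡n {y} y∈Sʲ y∈S>n+1 =
    ih y (Above-suc⇒Above (subst (λ i → Cell i y) (trans (sym (+-identityʳ j)) j+0≡n) y∈Sʲ)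
                          y∈S>n+1)
  RInvertible-below {n} ih (suc d) j j+1+d≡n {y} y∈Sʲ y∈S>n+1 k with transport? j k
  ... | inj₁ refl     = Cell⇒RInvertible y∈Sʲ
  ... | inj₂ (k' , t) = s-reflects-RInvertible t y∈Sʲ
                          (RInvertible-below ih d (suc j) 1+j+d≡n (s-cell j y y∈Sʲ)
                            (Above-s (s≤s 1+j≤n) y∈Sʲ y∈S>n+1) k')
    where
      1+j+d≡n : suc j + d ≡ n
      1+j+d≡n = trans (sym (+-suc j d)) j+1+d≡n
      1+j≤n : suc j ≤ n
      1+j≤n = subst (suc j ≤_) 1+j+d≡n (s≤s (m≤m+n j d))

  all-RInvertible-above : IsOmega0 C → ∀ n → AllRInvertibleAbove n
  all-RInvertible-above ω0 zero x x∈S>0 k = Cell⇒RInvertible (x∈S>0 k z≤n)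
  all-RInvertible-above ω0 (suc n) x x∈S>n+1 k with k ≤? n
  ... | no k≰n  = Cell⇒RInvertible (x∈S>n+1 k (≰⇒> k≰n))
  ... | yes k≤n = ω0 (suc n) k (s≤s z≤n) (s≤s k≤n) x x∈S>n+1 shell
    where
      shell : InvertibleShell (suc n) k x
      shell j (s≤s j≤n) _ α =
        RInvertible-below (all-RInvertible-above ω0 n) (n ∸ j) j (m+[n∸m]≡n j≤n)
          (Cell-δ j α x) (Above-δ α (s≤s j≤n) x∈S>n+1) k

proposition2p4p8 : (C : CubicalOmegaCategory) → IsOmega0 C →
                   ∀ k x → CubicalOmegaCategory.RInvertible C k x
proposition2p4p8 C ω0 k x with CubicalOmegaCategory.finite-dim C x
... | n , x∈S>n = CubicalProperties.all-RInvertible-above C ω0 n x x∈S>n k
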